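{- Let $(G,s,t,c)$ be a flow network with $G=(V,E)$ directed, with no parallel arcs and with at most one of $xy,yx$ in $E$ for every pair $x,y$, and let $r$ be an integer. Let $H=(V,F)$ be the undirected graph obtained by ignoring arc directions, with weight $w(\{x,y\})=c(xy)$ for each arc $xy\in E$. Define targets $\tau(v)=\sum_{xv\in E}c(xv)$ for $v\in V\setminus\{s,t\}$, $\tau(s)=\sum_{xs\in E}c(xs)+r$ and $\tau(t)=\sum_{xt\in E}c(xt)-r$. Then the following are equivalent: (1) there is an all-or-nothing flow of value $r$ in $G$; (2) $H$ has an orientation in which every vertex $v$ has weighted outdegree exactly $\tau(v)$; (3) $H$ has an orientation in which every vertex $v$ has weighted outdegree at least $\tau(v)$; (4) $H$ has an orientation in which every vertex $v$ has weighted outdegree at most $\tau(v)$.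
   Context: A flow is $f:E\to\mathbb{N}$ with $0\le f(e)\le c(e)$ and flow conservation at each vertex other than $s,t$; its value is $\sum_{sx\in E}f(sx)-\sum_{ws\in E}f(ws)$; it is all-or-nothing if $f(e)\in\{0,c(e)\}$ for every arc $e$. In an orientation of a weighted undirected graph, the weighted outdegree of $v$ is the sum of the weights of the edges oriented away from $v$. -}

module Defs where

open import Data.Nat using (ℕ; zero; suc)
open import Data.Integer using (ℤ; +_; -_; _+_; _-_; 0ℤ)
open import Data.Fin using (Fin; zero; suc; _≟_)
open import Data.Bool using (Bool; true; false; if_then_else_; T; _∨_)
open import Data.Product using (_×_)
open import Data.Sum using (_⊎_)
open import Relation.Nullary using (¬_; does)
open import Relation.Binary.PropositionalEquality using (_≡_; _≢_)
import Data.Nat as ℕ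

∑ : ∀ {n} → (Fin n → ℤ) → ℤ
∑ {zero}  f = 0ℤ
∑ {suc n} f = f zero + ∑ {n} (λ i → f (suc i))

-- A digraph on vertex set Fin n is an arc predicate E (E x y = true iff xy ∈ E);
-- this representation has no parallel arcs by construction.
Digraph : ℕ → Set
Digraph n = Fin n → Fin n → Bool

NoAntiparallel : ∀ {n} → Digraph n → Set
NoAntiparallel {n} E = (x y : Fin n) → T (E x y) → T (E y x) → x ≡ y

inSum : ∀ {n} → Digraph n → (Fin n → Fin n → ℕ) → Fin n → ℤ
inSum E g v = ∑ (λ x → if E x v then + g x v else 0ℤ)

outSum : ∀ {n} → Digraph n → (Fin n → Fin n → ℕ) → Fin n → ℤ
outSum E g v = ∑ (λ y → if E v y then + g v y else 0ℤ)

-- f is a flow in the network (G = E, s, t, c); only the values of f on arcs matter.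
record IsFlow {n} (E : Digraph n) (s t : Fin n) (c : Fin n → Fin n → ℕ)
              (f : Fin n → Fin n → ℕ) : Set where
  field
    capacity     : (x y : Fin n) → T (E x y) → f x y ℕ.≤ c x y
    conservation : (v : Fin n) → v ≢ s → v ≢ t → inSum E f v ≡ outSum E f v

flowValue : ∀ {n} → Digraph n → Fin n → (Fin n → Fin n → ℕ) → ℤ
flowValue E s f = outSum E f s - inSum E f s

AllOrNothing : ∀ {n} → Digraph n → (Fin n → Fin n → ℕ) → (Fin n → Fin n → ℕ) → Set
AllOrNothing {n} E c f = (x y : Fin n) → T (E x y) → (f x y ≡ 0) ⊎ (f x y ≡ c x y)

record WGraph (n : ℕ) : Set where
  field
    adj : Fin n → Fin n → Bool
    w   : Fin n → Fin n → ℕ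

-- An orientation of an undirected graph with adjacency adj: a digraph D that
-- uses only edges of the graph and gives every edge {x,y} exactly one direction.
-- (A loop, if any, necessarily becomes an arc vv.)
record IsOrientation {n} (H : WGraph n) (D : Digraph n) : Set where
  open WGraph H
  field
    sub      : (x y : Fin n) → T (D x y) → T (adj x y)
    covers   : (x y : Fin n) → T (adj x y) → T (D x y) ⊎ T (D y x)
    oneWay   : (x y : Fin n) → x ≢ y → T (D x y) → ¬ T (D y x)

weightedOutdeg : ∀ {n} → WGraph n → Digraph n → Fin n → ℤ
weightedOutdeg H D v = ∑ (λ y → if D v y then + WGraph.w H v y else 0ℤ)

underlying : ∀ {n} → Digraph n → (Fin n → Fin n → ℕ) → WGraph n
underlying E c = record
  { adj = λ x y → E x y ∨ E y x
  ; w   = λ x y → if E x y then c x y else c y x }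

τ : ∀ {n} → Digraph n → (Fin n → Fin n → ℕ) → Fin n → Fin n → ℤ → Fin n → ℤ
τ E c s t r v =
  if does (v ≟ s) then inSum E c v + r
  else if does (v ≟ t) then inSum E c v - r
  else inSum E c v

-- Orient an arc xy of G forwards if f saturates it and backwards if f(xy) = 0.
-- Every all-or-nothing flow f and the orientation it induces satisfy
--   outdeg(v) = Σ_{xv ∈ E} c(xv) + (net outflow of f at v),
-- so conservation at v ≠ s,t and value r at s say exactly that outdeg = τ there;
-- conversely every orientation induces an all-or-nothing flow this way.
-- Every orientation has total outdegree Σ_{e} c(e) = Σ_v τ(v), which settles the
-- sink and turns the one-sided bounds (3), (4) into equalities: a pointwise
-- inequality between functions with the same sum is an equality.

module Submission where

open import Defs
open import Data.Nat using (ℕ; zero; suc; _≡ᵇ_; z≤n) renaming (_≤_ to _≤ℕ_)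
open import Data.Integer.Tactic.RingSolver using (solve-∀)
open import Data.Nat.Properties using (≡ᵇ⇒≡; ≡⇒≡ᵇ) renaming (≤-refl to ≤ℕ-refl)
open import Data.Integer using (ℤ; +_; -_; _+_; _-_; 0ℤ; _≤_; _≥_)
open import Data.Integer.Properties
  using (+-comm; +-identityˡ; +-identityʳ; +-inverseʳ; +-mono-≤; +-mono-<-≤; ≤-refl; ≤-reflexive;
         ≤∧≢⇒<; <⇒≢; +-0-commutativeMonoid; +-0-abelianGroup; i-j≡0⇒i≡j)
  renaming (_≟_ to _≟ℤ_)
open import Algebra.Properties.AbelianGroup +-0-abelianGroup using (∙-cancelˡ; ∙-cancelʳ)
import Algebra.Properties.CommutativeMonoid.Sum +-0-commutativeMonoid as ℤSum
open import Data.Fin using (Fin; zero; suc; _≟_)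
open import Data.Fin.Properties using (suc-injective)
open import Data.Bool using (true; false; T; not; _∧_; _∨_; if_then_else_)
open import Data.Bool.Properties using (if-float; T-≡)
open import Data.Empty using (⊥-elim)
open import Data.Product using (Σ; _×_; _,_)
open import Data.Sum using (_⊎_; inj₁; inj₂; [_,_]; swap; reduce)
open import Function using (_∘_; flip; case_of_; Equivalence)
open import Function.Bundles using (_⇔_; mk⇔)
open import Relation.Nullary using (¬_; does; yes; no)
open import Relation.Nullary.Decidable using (dec-true; dec-false; decidable-stable)
open import Relation.Binary.PropositionalEquality
  using (_≡_; _≢_; refl; sym; trans; cong; cong₂; subst; module ≡-Reasoning)
open ≡-Reasoning

∑-cong : ∀ {n} {f g : Fin n → ℤ} → (∀ i → f i ≡ g i) → ∑ f ≡ ∑ g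
∑-cong {zero}  f≗g = refl
∑-cong {suc n} f≗g = cong₂ _+_ (f≗g zero) (∑-cong (f≗g ∘ suc))

∑-mono-≤ : ∀ {n} {f g : Fin n → ℤ} → (∀ i → f i ≤ g i) → ∑ f ≤ ∑ g
∑-mono-≤ {zero}  f≤g = ≤-refl
∑-mono-≤ {suc n} f≤g = +-mono-≤ (f≤g zero) (∑-mono-≤ (f≤g ∘ suc))

∑≡sum : ∀ {n} (f : Fin n → ℤ) → ∑ f ≡ ℤSum.sum f
∑≡sum {zero}  f = refl
∑≡sum {suc n} f = cong (_+_ (f zero)) (∑≡sum (f ∘ suc))

∑-distrib-+ : ∀ {n} (f g : Fin n → ℤ) → ∑ (λ i → f i + g i) ≡ ∑ f + ∑ g
∑-distrib-+ f g = begin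
  ∑ (λ i → f i + g i)           ≡⟨ ∑≡sum (λ i → f i + g i) ⟩
  ℤSum.sum (λ i → f i + g i)    ≡⟨ ℤSum.∑-distrib-+ f g ⟩
  ℤSum.sum f + ℤSum.sum g       ≡⟨ cong₂ _+_ (∑≡sum f) (∑≡sum g) ⟨
  ∑ f + ∑ g                     ∎

∑-comm : ∀ {m n} (f : Fin m → Fin n → ℤ) → ∑ (λ i → ∑ (f i)) ≡ ∑ (λ j → ∑ (λ i → f i j))
∑-comm f = begin
  ∑ (λ i → ∑ (f i))                          ≡⟨ ∑∑≡sumsum f ⟩
  ℤSum.sum (λ i → ℤSum.sum (f i))            ≡⟨ ℤSum.∑-comm f ⟩
  ℤSum.sum (λ j → ℤSum.sum (λ i → f i j))    ≡⟨ ∑∑≡sumsum (flip f) ⟨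
  ∑ (λ j → ∑ (λ i → f i j))                  ∎
  where
  ∑∑≡sumsum : ∀ {m n} (g : Fin m → Fin n → ℤ) → ∑ (λ i → ∑ (g i)) ≡ ℤSum.sum (λ i → ℤSum.sum (g i))
  ∑∑≡sumsum g = trans (∑≡sum (λ i → ∑ (g i))) (ℤSum.sum-cong-≗ (∑≡sum ∘ g))

∑-zero : ∀ n → ∑ {n} (λ _ → 0ℤ) ≡ 0ℤ
∑-zero n = trans (∑≡sum {n} (λ _ → 0ℤ)) (ℤSum.sum-replicate-zero n)

indicator : ∀ {n} → Fin n → ℤ → Fin n → ℤ
indicator s x v = if does (v ≟ s) then x else 0ℤ

∑-indicator : ∀ {n} (s : Fin n) (x : ℤ) → ∑ (indicator s x) ≡ x
∑-indicator {suc n} zero    x = trans (cong (_+_ x) (∑-zero n)) (+-identityʳ x)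
∑-indicator         (suc s) x = trans (+-identityˡ _) (∑-indicator s x)

+-≤-≡⇒≡ˡ : ∀ {a b c d : ℤ} → a ≤ b → c ≤ d → a + c ≡ b + d → a ≡ b
+-≤-≡⇒≡ˡ {a} {b} a≤b c≤d eq =
  decidable-stable (a ≟ℤ b) (λ a≢b → <⇒≢ (+-mono-<-≤ (≤∧≢⇒< a≤b a≢b) c≤d) eq)

≤-pointwise∧∑≡⇒≗ : ∀ {n} (f g : Fin n → ℤ) → (∀ i → f i ≤ g i) → ∑ f ≡ ∑ g → ∀ i → f i ≡ g i
≤-pointwise∧∑≡⇒≗ f g f≤g ∑f≡∑g zero    = f₀≡g₀
  where f₀≡g₀ = +-≤-≡⇒≡ˡ (f≤g zero) (∑-mono-≤ (f≤g ∘ suc)) ∑f≡∑g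
≤-pointwise∧∑≡⇒≗ f g f≤g ∑f≡∑g (suc i) =
  ≤-pointwise∧∑≡⇒≗ (f ∘ suc) (g ∘ suc) (f≤g ∘ suc)
    (∙-cancelˡ (f zero) _ _ (trans ∑f≡∑g (cong₂ _+_ (sym f₀≡g₀) refl))) i
  where f₀≡g₀ = ≤-pointwise∧∑≡⇒≗ f g f≤g ∑f≡∑g zero

≗-except∧∑≡⇒≡ : ∀ {n} (f g : Fin n → ℤ) (t : Fin n) → (∀ i → i ≢ t → f i ≡ g i) → ∑ f ≡ ∑ g → f t ≡ g t
≗-except∧∑≡⇒≡ f g zero    f≗g ∑f≡∑g =
  ∙-cancelʳ _ (f zero) (g zero) (trans (cong (_+_ (f zero)) (sym (∑-cong (λ i → f≗g (suc i) λ ())))) ∑f≡∑g)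
≗-except∧∑≡⇒≡ f g (suc t) f≗g ∑f≡∑g =
  ≗-except∧∑≡⇒≡ (f ∘ suc) (g ∘ suc) t (λ i i≢t → f≗g (suc i) (i≢t ∘ suc-injective))
    (∙-cancelˡ (f zero) _ _ (trans ∑f≡∑g (cong₂ _+_ (sym (f≗g zero λ ())) refl)))

x+y≡z+w⇒x≡w+[z-y] : ∀ {x y z w : ℤ} → x + y ≡ z + w → x ≡ w + (z - y)
x+y≡z+w⇒x≡w+[z-y] {x} {y} {z} {w} eq = ∙-cancelʳ y x (w + (z - y)) (trans eq (rearrange z w y))
  where
  rearrange : ∀ z w y → z + w ≡ w + (z - y) + y
  rearrange = solve-∀

holds : ∀ {b} → b ≡ true → T b
holds = Equivalence.from T-≡

T⊎T-not : ∀ b → T b ⊎ T (not b)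
T⊎T-not true  = inj₁ _
T⊎T-not false = inj₂ _

T-not⇒¬T : ∀ {b} → T (not b) → ¬ T b
T-not⇒¬T {false} _ ()

module _ {n} {H : WGraph n} {D : Digraph n} (O : IsOrientation H D) where
  open WGraph H
  open IsOrientation O

  orientation-absent : ∀ x y → ¬ T (adj x y) → D x y ≡ false
  orientation-absent x y ¬adj with D x y in Dxy
  ... | true  = ⊥-elim (¬adj (sub x y (holds Dxy)))
  ... | false = refl

  orientation-loop : ∀ v → D v v ≡ adj v v
  orientation-loop v with adj v v in adjvv
  ... | false = orientation-absent v v (subst T adjvv)
  ... | true  = Equivalence.to T-≡ (reduce (covers v v (holds adjvv)))

  orientation-flip : ∀ x y → x ≢ y → T (adj x y) → D y x ≡ not (D x y)
  orientation-flip x y x≢y adjxy with D x y in Dxy | D y x in Dyx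
  ... | true  | true  = ⊥-elim (oneWay x y x≢y (holds Dxy) (holds Dyx))
  ... | true  | false = refl
  ... | false | true  = refl
  ... | false | false = ⊥-elim ([ subst T Dxy , subst T Dyx ] (covers x y adjxy))

≡0⊎≡⇒≡if-≡ᵇ : ∀ {a b : ℕ} → a ≡ 0 ⊎ a ≡ b → a ≡ (if a ≡ᵇ b then b else 0)
≡0⊎≡⇒≡if-≡ᵇ {a} {b} a≡0⊎a≡b with a ≡ᵇ b in a≡ᵇb | a≡0⊎a≡b
... | true  | _       = ≡ᵇ⇒≡ a b (holds a≡ᵇb)
... | false | inj₁ a≡0 = a≡0
... | false | inj₂ a≡b = ⊥-elim (subst T a≡ᵇb (≡⇒≡ᵇ a b a≡b))

∑-inSum≡∑-outSum : ∀ {n} (E : Digraph n) (g : Fin n → Fin n → ℕ) → ∑ (inSum E g) ≡ ∑ (outSum E g)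
∑-inSum≡∑-outSum E g = ∑-comm (λ v x → if E x v then + g x v else 0ℤ)

module FlowOrientation {n} (E : Digraph n) (c : Fin n → Fin n → ℕ) (nap : NoAntiparallel E) where

  H : WGraph n
  H = underlying E c

  flowOf : Digraph n → Fin n → Fin n → ℕ
  flowOf D x y = if D x y then c x y else 0

  -- The disjunct E y x only matters for loops, which every orientation keeps.
  orientationOf : (Fin n → Fin n → ℕ) → Digraph n
  orientationOf f x y = if E x y then E y x ∨ (f x y ≡ᵇ c x y) else E y x ∧ not (f y x ≡ᵇ c y x)

  -- Loops are exempt: whatever a loop carries cancels in the net outflow.
  _Induces_ : Digraph n → (Fin n → Fin n → ℕ) → Set
  D Induces f = ∀ x y → T (E x y) → x ≢ y → f x y ≡ flowOf D x y

  orientationOf-isOrientation : ∀ f → IsOrientation H (orientationOf f)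
  orientationOf-isOrientation f = record { sub = sub ; covers = covers ; oneWay = oneWay }
    where
    sub : ∀ x y → T (orientationOf f x y) → T (E x y ∨ E y x)
    sub x y with E x y | E y x
    ... | true  | _     = λ _ → _
    ... | false | true  = λ _ → _
    ... | false | false = λ ()
    covers : ∀ x y → T (E x y ∨ E y x) → T (orientationOf f x y) ⊎ T (orientationOf f y x)
    covers x y with E x y | E y x
    ... | true  | true  = λ _ → inj₁ _
    ... | true  | false = λ _ → T⊎T-not (f x y ≡ᵇ c x y)
    ... | false | true  = λ _ → swap (T⊎T-not (f y x ≡ᵇ c y x))
    ... | false | false = λ ()
    oneWay : ∀ x y → x ≢ y → T (orientationOf f x y) → ¬ T (orientationOf f y x)
    oneWay x y x≢y with E x y in Exy | E y x in Eyx
    ... | true  | true  = ⊥-elim (x≢y (nap x y (holds Exy) (holds Eyx)))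
    ... | true  | false = λ sat unsat → T-not⇒¬T unsat sat
    ... | false | true  = T-not⇒¬T
    ... | false | false = λ ()

  orientationOf-induces : ∀ f → AllOrNothing E c f → orientationOf f Induces f
  orientationOf-induces f aon x y Exy x≢y with E x y in Exy≡ | E y x in Eyx≡
  ... | true  | true  = ⊥-elim (x≢y (nap x y (holds Exy≡) (holds Eyx≡)))
  ... | true  | false = ≡0⊎≡⇒≡if-≡ᵇ (aon x y (holds Exy≡))

  arc-balance : ∀ {D f} → IsOrientation H D → D Induces f → ∀ v y →
    (if D v y then + WGraph.w H v y else 0ℤ) + (if E y v then + f y v else 0ℤ)
      ≡ (if E v y then + f v y else 0ℤ) + (if E y v then + c y v else 0ℤ)
  arc-balance {D} {f} O ind v y with v ≟ y
  ... | yes refl rewrite orientation-loop O v with E v v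
  ...   | true  = +-comm (+ c v v) (+ f v v)
  ...   | false = refl
  arc-balance {D} O ind v y | no v≢y with E v y in Evy | E y v in Eyv
  ...   | true  | true  = ⊥-elim (v≢y (nap v y (holds Evy) (holds Eyv)))
  ...   | true  | false = cong₂ _+_ (sym (trans (cong +_ (ind v y (holds Evy) v≢y)) (if-float +_ (D v y)))) refl
  ...   | false | false rewrite orientation-absent O v y (subst T (cong₂ _∨_ Evy Eyv)) = refl
  ...   | false | true
    rewrite ind y v (holds Eyv) (v≢y ∘ sym)
          | orientation-flip O v y v≢y (subst T (sym (cong₂ _∨_ Evy Eyv)) _)
    with D v y
  ...   | true  = +-identityʳ _
  ...   | false = refl

  flowOf-induces : ∀ D → D Induces flowOf D
  flowOf-induces D x y _ _ = refl

  flowOf-≤ : ∀ D x y → T (E x y) → flowOf D x y ≤ℕ c x y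
  flowOf-≤ D x y _ with D x y
  ... | true  = ≤ℕ-refl
  ... | false = z≤n

  flowOf-allOrNothing : ∀ D → AllOrNothing E c (flowOf D)
  flowOf-allOrNothing D x y _ with D x y
  ... | true  = inj₂ refl
  ... | false = inj₁ refl

  outdeg+inflow≡outflow+inCapacity : ∀ {D f} → IsOrientation H D → D Induces f → ∀ v →
    weightedOutdeg H D v + inSum E f v ≡ outSum E f v + inSum E c v
  outdeg+inflow≡outflow+inCapacity {D} {f} O ind v = begin
    weightedOutdeg H D v + inSum E f v    ≡⟨ ∑-distrib-+ outdegTerm (inTerm f) ⟨
    ∑ (λ y → outdegTerm y + inTerm f y)   ≡⟨ ∑-cong (arc-balance O ind v) ⟩
    ∑ (λ y → outTerm y + inTerm c y)      ≡⟨ ∑-distrib-+ outTerm (inTerm c) ⟩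
    outSum E f v + inSum E c v            ∎
    where
    outdegTerm outTerm : Fin n → ℤ
    outdegTerm y = if D v y then + WGraph.w H v y else 0ℤ
    outTerm    y = if E v y then + f v y else 0ℤ
    inTerm : (Fin n → Fin n → ℕ) → Fin n → ℤ
    inTerm g y = if E y v then + g y v else 0ℤ

  outdeg≡inCapacity+netOutflow : ∀ {D f} → IsOrientation H D → D Induces f → ∀ v →
    weightedOutdeg H D v ≡ inSum E c v + (outSum E f v - inSum E f v)
  outdeg≡inCapacity+netOutflow {f = f} O ind v =
    x+y≡z+w⇒x≡w+[z-y] {z = outSum E f v} {w = inSum E c v} (outdeg+inflow≡outflow+inCapacity O ind v)

  ∑-outdeg≡∑-inCapacity : ∀ {D} → IsOrientation H D → ∑ (weightedOutdeg H D) ≡ ∑ (inSum E c)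
  ∑-outdeg≡∑-inCapacity {D} O = ∙-cancelʳ (∑ (inSum E F)) _ _ (begin
    ∑ (weightedOutdeg H D) + ∑ (inSum E F)   ≡⟨ ∑-distrib-+ (weightedOutdeg H D) (inSum E F) ⟨
    ∑ (λ v → weightedOutdeg H D v + inSum E F v)
                                             ≡⟨ ∑-cong (outdeg+inflow≡outflow+inCapacity O (flowOf-induces D)) ⟩
    ∑ (λ v → outSum E F v + inSum E c v)     ≡⟨ ∑-distrib-+ (outSum E F) (inSum E c) ⟩
    ∑ (outSum E F) + ∑ (inSum E c)           ≡⟨ cong₂ _+_ (∑-inSum≡∑-outSum E F) refl ⟨
    ∑ (inSum E F) + ∑ (inSum E c)            ≡⟨ +-comm (∑ (inSum E F)) (∑ (inSum E c)) ⟩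
    ∑ (inSum E c) + ∑ (inSum E F)            ∎)
    where F = flowOf D

module _ {n} (E : Digraph n) (c : Fin n → Fin n → ℕ) (s t : Fin n) (r : ℤ) where

  τ-source : τ E c s t r s ≡ inSum E c s + r
  τ-source rewrite dec-true (s ≟ s) refl = refl

  τ-inner : ∀ {v} → v ≢ s → v ≢ t → τ E c s t r v ≡ inSum E c v
  τ-inner {v} v≢s v≢t rewrite dec-false (v ≟ s) v≢s | dec-false (v ≟ t) v≢t = refl

  τ-shift : Fin n → ℤ
  τ-shift v = indicator s r v + indicator t (- r) v

  τ≡inCapacity+shift : s ≢ t → ∀ v → τ E c s t r v ≡ inSum E c v + τ-shift v
  τ≡inCapacity+shift s≢t v with v ≟ s | v ≟ t
  ... | yes v≡s | yes v≡t = ⊥-elim (s≢t (trans (sym v≡s) v≡t))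
  ... | yes _   | no _    = cong (_+_ (inSum E c v)) (sym (+-identityʳ r))
  ... | no _    | yes _   = cong (_+_ (inSum E c v)) (sym (+-identityˡ (- r)))
  ... | no _    | no _    = sym (+-identityʳ (inSum E c v))

  ∑τ-shift≡0 : ∑ τ-shift ≡ 0ℤ
  ∑τ-shift≡0 = begin
    ∑ τ-shift                                       ≡⟨ ∑-distrib-+ (indicator s r) (indicator t (- r)) ⟩
    ∑ (indicator s r) + ∑ (indicator t (- r))       ≡⟨ cong₂ _+_ (∑-indicator s r) (∑-indicator t (- r)) ⟩
    r - r                                           ≡⟨ +-inverseʳ r ⟩
    0ℤ                                              ∎

  ∑τ≡∑inCapacity : s ≢ t → ∑ (τ E c s t r) ≡ ∑ (inSum E c)
  ∑τ≡∑inCapacity s≢t = begin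
    ∑ (τ E c s t r)                            ≡⟨ ∑-cong (τ≡inCapacity+shift s≢t) ⟩
    ∑ (λ v → inSum E c v + τ-shift v)          ≡⟨ ∑-distrib-+ (inSum E c) τ-shift ⟩
    ∑ (inSum E c) + ∑ τ-shift                  ≡⟨ cong (_+_ (∑ (inSum E c))) ∑τ-shift≡0 ⟩
    ∑ (inSum E c) + 0ℤ                         ≡⟨ +-identityʳ (∑ (inSum E c)) ⟩
    ∑ (inSum E c)                              ∎

module AllOrNothingFlows {n} (E : Digraph n) {s t : Fin n} (s≢t : s ≢ t)
    (c : Fin n → Fin n → ℕ) (nap : NoAntiparallel E) (r : ℤ) where
  open FlowOrientation E c nap

  AllOrNothingFlow : Set
  AllOrNothingFlow = Σ (Fin n → Fin n → ℕ) λ f → IsFlow E s t c f × AllOrNothing E c f × flowValue E s f ≡ r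

  OrientationWithOutdeg : (ℤ → ℤ → Set) → Set
  OrientationWithOutdeg _∼_ = Σ (Digraph n) λ D → IsOrientation H D × (∀ v → weightedOutdeg H D v ∼ τ E c s t r v)

  ∑-outdeg≡∑τ : ∀ {D} → IsOrientation H D → ∑ (weightedOutdeg H D) ≡ ∑ (τ E c s t r)
  ∑-outdeg≡∑τ O = trans (∑-outdeg≡∑-inCapacity O) (sym (∑τ≡∑inCapacity E c s t r s≢t))

  flow⇒exact : AllOrNothingFlow → OrientationWithOutdeg _≡_
  flow⇒exact (f , isFlow , aon , value) = D , O , outdeg≡τ
    where
    open IsFlow isFlow
    D = orientationOf f
    O = orientationOf-isOrientation f
    outdeg≡ : ∀ v → weightedOutdeg H D v ≡ inSum E c v + (outSum E f v - inSum E f v)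
    outdeg≡ = outdeg≡inCapacity+netOutflow O (orientationOf-induces f aon)
    outdeg≡τ-source : weightedOutdeg H D s ≡ τ E c s t r s
    outdeg≡τ-source = begin
      weightedOutdeg H D s                          ≡⟨ outdeg≡ s ⟩
      inSum E c s + (outSum E f s - inSum E f s)    ≡⟨ cong (_+_ (inSum E c s)) value ⟩
      inSum E c s + r                               ≡⟨ τ-source E c s t r ⟨
      τ E c s t r s                                 ∎
    outdeg≡τ-inner : ∀ v → v ≢ s → v ≢ t → weightedOutdeg H D v ≡ τ E c s t r v
    outdeg≡τ-inner v v≢s v≢t = begin
      weightedOutdeg H D v                          ≡⟨ outdeg≡ v ⟩
      inSum E c v + (outSum E f v - inSum E f v)    ≡⟨ cong (λ i → inSum E c v + (outSum E f v - i)) (conservation v v≢s v≢t) ⟩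
      inSum E c v + (outSum E f v - outSum E f v)   ≡⟨ cong (_+_ (inSum E c v)) (+-inverseʳ (outSum E f v)) ⟩
      inSum E c v + 0ℤ                              ≡⟨ +-identityʳ (inSum E c v) ⟩
      inSum E c v                                   ≡⟨ τ-inner E c s t r v≢s v≢t ⟨
      τ E c s t r v                                 ∎
    outdeg≡τ-off-sink : ∀ v → v ≢ t → weightedOutdeg H D v ≡ τ E c s t r v
    outdeg≡τ-off-sink v v≢t = case v ≟ s of λ where
      (yes refl) → outdeg≡τ-source
      (no v≢s)   → outdeg≡τ-inner v v≢s v≢t
    outdeg≡τ : ∀ v → weightedOutdeg H D v ≡ τ E c s t r v
    outdeg≡τ v = case v ≟ t of λ where
      (yes refl) → ≗-except∧∑≡⇒≡ (weightedOutdeg H D) (τ E c s t r) t outdeg≡τ-off-sink (∑-outdeg≡∑τ O)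
      (no v≢t)   → outdeg≡τ-off-sink v v≢t

  exact⇒flow : OrientationWithOutdeg _≡_ → AllOrNothingFlow
  exact⇒flow (D , O , outdeg≡τ) =
    f , record { capacity = flowOf-≤ D ; conservation = conserved } , flowOf-allOrNothing D , value
    where
    f = flowOf D
    inCapacity+netOutflow≡τ : ∀ v → inSum E c v + (outSum E f v - inSum E f v) ≡ τ E c s t r v
    inCapacity+netOutflow≡τ v = trans (sym (outdeg≡inCapacity+netOutflow O (flowOf-induces D) v)) (outdeg≡τ v)
    conserved : ∀ v → v ≢ s → v ≢ t → inSum E f v ≡ outSum E f v
    conserved v v≢s v≢t = sym (i-j≡0⇒i≡j _ _ (∙-cancelˡ (inSum E c v) _ _
      (trans (inCapacity+netOutflow≡τ v) (trans (τ-inner E c s t r v≢s v≢t) (sym (+-identityʳ (inSum E c v)))))))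
    value : flowValue E s f ≡ r
    value = ∙-cancelˡ (inSum E c s) _ _ (trans (inCapacity+netOutflow≡τ s) (τ-source E c s t r))

  ≥⇒exact : OrientationWithOutdeg _≥_ → OrientationWithOutdeg _≡_
  ≥⇒exact (D , O , τ≤outdeg) =
    D , O , λ v → sym (≤-pointwise∧∑≡⇒≗ (τ E c s t r) (weightedOutdeg H D) τ≤outdeg (sym (∑-outdeg≡∑τ O)) v)

  ≤⇒exact : OrientationWithOutdeg _≤_ → OrientationWithOutdeg _≡_
  ≤⇒exact (D , O , outdeg≤τ) =
    D , O , ≤-pointwise∧∑≡⇒≗ (weightedOutdeg H D) (τ E c s t r) outdeg≤τ (∑-outdeg≡∑τ O)

  weaken : ∀ {_∼_ : ℤ → ℤ → Set} → (∀ {a b} → a ≡ b → a ∼ b) → OrientationWithOutdeg _≡_ → OrientationWithOutdeg _∼_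
  weaken ≡⇒∼ (D , O , outdeg≡τ) = D , O , ≡⇒∼ ∘ outdeg≡τ

mainTheorem10 : (n : ℕ) (E : Digraph n) (s t : Fin n) → s ≢ t →
    (c : Fin n → Fin n → ℕ) → NoAntiparallel E → (r : ℤ) →
    ((Σ (Fin n → Fin n → ℕ) λ f → IsFlow E s t c f × AllOrNothing E c f × flowValue E s f ≡ r)
      ⇔ (Σ (Digraph n) λ D → IsOrientation (underlying E c) D ×
           ((v : Fin n) → weightedOutdeg (underlying E c) D v ≡ τ E c s t r v)))
    × ((Σ (Fin n → Fin n → ℕ) λ f → IsFlow E s t c f × AllOrNothing E c f × flowValue E s f ≡ r)
      ⇔ (Σ (Digraph n) λ D → IsOrientation (underlying E c) D ×
           ((v : Fin n) → τ E c s t r v ≤ weightedOutdeg (underlying E c) D v)))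
    × ((Σ (Fin n → Fin n → ℕ) λ f → IsFlow E s t c f × AllOrNothing E c f × flowValue E s f ≡ r)
      ⇔ (Σ (Digraph n) λ D → IsOrientation (underlying E c) D ×
           ((v : Fin n) → weightedOutdeg (underlying E c) D v ≤ τ E c s t r v)))
mainTheorem10 n E s t s≢t c nap r =
    mk⇔ flow⇒exact exact⇒flow
  , mk⇔ (weaken (≤-reflexive ∘ sym) ∘ flow⇒exact) (exact⇒flow ∘ ≥⇒exact)
  , mk⇔ (weaken ≤-reflexive ∘ flow⇒exact) (exact⇒flow ∘ ≤⇒exact)
  where open AllOrNothingFlows E s≢t c nap r
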